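{- Consider an instance of the set cover problem with hard capacities (as defined in the context) that admits a valid set cover. Let $\mathcal{P}=\{S_1,S_2,\dots,S_m\}$ be the solution returned by Wolsey's greedy algorithm, listed in the order in which the sets were added, and for $0\le i\le m$ let $\mathcal{P}_i=\{S_1,\dots,S_i\}$. Then there exist a feasible cover $\mathcal{C}\subseteq\mathcal{P}\times X$ in which every element of $X$ is covered, and an ordering $x_1,x_2,\dots,x_n$ of the elements of $X$, such that for every $i$ with $1\le i\le m$: (a) $f_{\mathcal{C}}(\mathcal{P}_i)=f(\mathcal{P}_i)$, i.e. the sets of $\mathcal{P}_i$ cover $f(\mathcal{P}_i)$ elements in $\mathcal{C}$; and (b) the elements covered in $\mathcal{C}$ by sets of $\mathcal{P}_i$ are exactly $x_1,x_2,\dots,x_{f(\mathcal{P}_i)}$ (elements are indexed in the order in which they become covered).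
   Context: Hard capacitated set cover: a finite ground set $X$ with $|X|=n$ and a family $\mathcal{S}$ of subsets of $X$; each $S\in\mathcal{S}$ has a positive integer capacity $k(S)$ and a cost $w(S)>0$. For a subfamily $\mathcal{P}\subseteq\mathcal{S}$, a feasible partial cover is a set $\mathcal{C}\subseteq\mathcal{P}\times X$ such that $e\in S$ whenever $(S,e)\in\mathcal{C}$, each element $e\in X$ appears in at most one pair of $\mathcal{C}$, and each set $S$ appears in at most $k(S)$ pairs of $\mathcal{C}$; an element $e$ is covered by $S$ in $\mathcal{C}$ if $(S,e)\in\mathcal{C}$. A feasible cover is a feasible partial cover in which every element of $X$ is covered. $\mathcal{P}$ is a valid set cover if a feasible cover $\mathcal{C}\subseteq\mathcal{P}\times X$ exists. $f(\mathcal{P})$ denotes the maximum of $|\mathcal{C}|$ over all feasible partial covers $\mathcal{C}\subseteq\mathcal{P}\times X$. For a feasible partial cover $\mathcal{C}$ and a subfamily $\mathcal{R}'$, $f_{\mathcal{C}}(\mathcal{R}')$ is the number of elements covered in $\mathcal{C}$ by sets of $\mathcal{R}'$. For a subfamily $\mathcal{P}$ and a set $S$, $f_{\mathcal{P}}(S)=f(\mathcal{P}\cup\{S\})-f(\mathcal{P})$. Wolsey's greedy algorithm: start with $\mathcal{P}=\emptyset$; while $\mathcal{P}$ is not a valid set cover, choose $S\in\mathcal{S}$ with $f_{\mathcal{P}}(S)>0$ minimizing $w(S)/f_{\mathcal{P}}(S)$ and add it to $\mathcal{P}$; return $\mathcal{P}$.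
   Formalization: The costs $w(S)$ take values in the positive rationals. -}

module Defs where

open import Data.Nat using (ℕ; zero; suc; _⊔_; _∸_; _≤?_) renaming (_≤_ to _≤ℕ_)
open import Data.Bool using (Bool; true; false)
open import Data.Fin using (Fin)
open import Data.Fin.Subset using (Subset; _∈_; ⁅_⁆; _∪_; ⊥)
open import Data.Fin.Subset.Properties using (_∈?_)
open import Data.Fin.Properties using (all?) renaming (_≟_ to _≟F_)
open import Data.Maybe using (Maybe; just; nothing; Is-just)
open import Data.Vec using (Vec; []; _∷_; lookup)
open import Data.List using (List; []; _∷_; map; concatMap; filter; foldr; allFin)
open import Data.Product using (_×_; ∃; _,_)
open import Data.Unit using (⊤; tt)
open import Data.Integer using (+_)
open import Data.Rational using (ℚ; _/_)
open import Relation.Nullary using (Dec; yes; no; does; ¬_)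
open import Relation.Nullary.Decidable using (_×-dec_)
open import Relation.Binary.PropositionalEquality using (_≡_)
open import Data.Fin using (toℕ)
open import Data.Nat using (_<_)
open import Data.List using (length; take) renaming (lookup to lookupL)
open import Data.Rational using (_*_) renaming (_≤_ to _≤ℚ_)

-- Ground set X = Fin n; the family S consists of s sets indexed by Fin s,
-- set number S being  mem S : Subset n.  Capacities  k : Fin s → ℕ.
-- A subfamily is a  Subset s.
--
-- A (candidate) partial cover C ⊆ S × X in which each element occurs in at
-- most one pair is encoded as a vector  c : Vec (Maybe (Fin s)) n :
-- (S , e) ∈ C  iff  lookup c e ≡ just S.

Cover : ℕ → ℕ → Set
Cover n s = Vec (Maybe (Fin s)) n

countV : ∀ {s m} → (Maybe (Fin s) → Bool) → Vec (Maybe (Fin s)) m → ℕ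
countV p [] = 0
countV p (x ∷ xs) with p x
... | true  = suc (countV p xs)
... | false = countV p xs

isJust : ∀ {s} → Maybe (Fin s) → Bool
isJust nothing  = false
isJust (just _) = true

isSet : ∀ {s} → Fin s → Maybe (Fin s) → Bool
isSet S nothing  = false
isSet S (just T) = does (T ≟F S)

inFam : ∀ {s} → Subset s → Maybe (Fin s) → Bool
inFam R nothing  = false
inFam R (just T) = does (T ∈? R)

size : ∀ {n s} → Cover n s → ℕ
size = countV isJust

load : ∀ {n s} → Cover n s → Fin s → ℕ
load c S = countV (isSet S) c

fC : ∀ {n s} → Cover n s → Subset s → ℕ
fC c R = countV (inFam R) c

CoveredBy : ∀ {n s} → Cover n s → Subset s → Fin n → Set
CoveredBy c R e = ∃ λ S → lookup c e ≡ just S × S ∈ R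

FullCover : ∀ {n s} → Cover n s → Set
FullCover {n} c = (e : Fin n) → Is-just (lookup c e)

module _ {n s : ℕ} (mem : Fin s → Subset n) (k : Fin s → ℕ) where

  Assign : Subset s → Fin n → Maybe (Fin s) → Set
  Assign P e nothing  = ⊤
  Assign P e (just S) = S ∈ P × e ∈ mem S

  assign? : ∀ P e m → Dec (Assign P e m)
  assign? P e nothing  = yes tt
  assign? P e (just S) = (S ∈? P) ×-dec (e ∈? mem S)

  Feasible : Subset s → Cover n s → Set
  Feasible P c = ((e : Fin n) → Assign P e (lookup c e))
               × ((S : Fin s) → load c S ≤ℕ k S)

  feasible? : ∀ P c → Dec (Feasible P c)
  feasible? P c = all? (λ e → assign? P e (lookup c e)) ×-dec all? (λ S → load c S ≤? k S)

  Valid : Subset s → Set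
  Valid P = ∃ λ (c : Cover n s) → Feasible P c × FullCover c

  allMaybe : List (Maybe (Fin s))
  allMaybe = nothing ∷ map just (allFin s)

  allCovers : (m : ℕ) → List (Vec (Maybe (Fin s)) m)
  allCovers zero    = [] ∷ []
  allCovers (suc m) = concatMap (λ x → map (x ∷_) (allCovers m)) allMaybe

  f : Subset s → ℕ
  f P = foldr _⊔_ 0 (map size (filter (feasible? P) (allCovers n)))

  gain : Subset s → Fin s → ℕ
  gain P S = f (P ∪ ⁅ S ⁆) ∸ f P

toSub : ∀ {s} → List (Fin s) → Subset s
toSub = foldr (λ S P → ⁅ S ⁆ ∪ P) ⊥

ℕ→ℚ : ℕ → ℚ
ℕ→ℚ g = + g / 1

Pref : ∀ {s} → List (Fin s) → ℕ → Subset s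
Pref seq i = toSub (take i seq)

-- seq = S_1, …, S_m is a complete run of Wolsey's greedy algorithm
-- (with some tie-breaking): at step i (P = P_i, S = S_{i+1}) P is not a
-- valid set cover, f_P(S) > 0 and w(S)/f_P(S) ≤ w(T)/f_P(T) for every T
-- with f_P(T) > 0 (written with denominators cleared); finally P_m is valid.
GreedyRun : ∀ {n s} → (Fin s → Subset n) → (Fin s → ℕ) → (Fin s → ℚ)
          → List (Fin s) → Set
GreedyRun {n} {s} mem k w seq =
    ((i : Fin (length seq)) →
        ¬ Valid mem k (Pref seq (toℕ i))
      × 0 < gain mem k (Pref seq (toℕ i)) (lookupL seq i)
      × ((T : Fin s) → 0 < gain mem k (Pref seq (toℕ i)) T →
           (w (lookupL seq i) * ℕ→ℚ (gain mem k (Pref seq (toℕ i)) T))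
             ≤ℚ (w T * ℕ→ℚ (gain mem k (Pref seq (toℕ i)) (lookupL seq i)))))
  × Valid mem k (toSub seq)

-- Within a fixed subfamily Q, feasible partial covers have a matroid-like augmentation property:
-- a smaller one can be enlarged by one element, either by giving an element it leaves uncovered
-- to a set with spare capacity, or, if that set is saturated, by first releasing one of its
-- elements that the larger cover assigns elsewhere, which brings the two covers strictly closer.
-- These moves never decrease the number of elements covered by any subfamily, so a maximum
-- cover of P_i extends to a maximum cover of P_(i+1) that is still maximum on P_i; iterating
-- gives one cover that is maximum on every prefix. Listing the elements by the position of
-- their covering set in the sequence gives the ordering.

module Submission where

open import Defs
open import Data.Nat using (ℕ; _≤_; _<_)
open import Data.Fin using (Fin; toℕ)
open import Data.Fin.Subset using (Subset; ⊤)
open import Data.Fin.Permutation using (Permutation′; _⟨$⟩ʳ_)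
open import Data.List using (List; length)
open import Data.Product using (_×_; ∃)
open import Data.Rational using (ℚ; 0ℚ) renaming (_<_ to _<ℚ_)
open import Relation.Binary.PropositionalEquality using (_≡_)

open import Data.Nat using (zero; suc; _+_; _*_; _∸_; _⊔_; z≤n; s≤s; z<s; _<?_)
open import Data.Nat.Properties
open import Data.Bool using (Bool; true; false; not)
open import Data.Bool.Properties using () renaming (_≟_ to _≟ᵇ_)
open import Data.Fin using (fromℕ<; punchOut) renaming (zero to fzero; suc to fsuc)
open import Data.Fin.Properties using (any?; toℕ<n; toℕ-fromℕ<; toℕ-injective; punchOut-injective; injective⇒≤)
  renaming (_≟_ to _≟F_)
open import Data.Fin.Subset using (_∈_; _⊆_; ∣_∣; ⁅_⁆)
open import Data.Fin.Subset.Properties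
  using (_∈?_; p⊆q⇒∣p∣≤∣q∣; p⊂q⇒∣p∣<∣q∣; ∣p∣≤n; ∣p∣≡n⇒p≡⊤; ∣⊤∣≡n; ∉⊥; x∈p∪q⁻; x∈p∪q⁺; x∈⁅x⁆; x∈⁅y⁆⇒x≡y)
open import Data.Fin.Permutation using (permutation)
open import Data.Vec using (Vec; []; _∷_; lookup; tabulate; replicate; _[_]≔_) renaming (map to mapᵥ)
open import Data.Vec.Properties
  using (lookup∘tabulate; tabulate-cong; lookup⇒[]=; []=⇒lookup; lookup-replicate; lookup-map; lookup∘update; lookup∘update′)
open import Data.List using ([]; _∷_; map; filter)
open import Data.List.Properties using (foldr-preservesᵇ; foldr-preservesᵒ; take-all)
open import Data.List.Membership.Propositional using (lose) renaming (_∈_ to _∈ₗ_)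
open import Data.List.Membership.Propositional.Properties
  using (∈-map⁺; ∈-map⁻; ∈-filter⁺; ∈-filter⁻; ∈-concatMap⁺; ∈-allFin)
open import Data.List.Relation.Unary.All using () renaming (tabulate to tabulateₐ)
open import Data.List.Relation.Unary.Any using (here; there)
open import Data.Maybe using (Maybe; just; nothing; Is-just)
open import Data.Maybe.Relation.Unary.Any using (just)
import Data.Maybe.Properties as Maybe
open import Data.Product using (_,_; proj₁; proj₂)
open import Data.Sum using (_⊎_; inj₁; inj₂)
open import Data.Empty using (⊥-elim)
open import Data.Unit using (tt)
open import Function using (_∘_; _⇔_; mk⇔; Equivalence; Injective)
import Function.Properties.Equivalence as ⇔
open import Relation.Nullary using (Dec; yes; no; does; _×-dec_; map′)
open import Relation.Nullary.Decidable using (dec-true; dec-false; does-⇔)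
open import Relation.Binary.PropositionalEquality using (_≢_; module ≡-Reasoning; refl; sym; trans; cong; subst; subst₂)
open import Relation.Binary.Definitions using (tri<; tri≈; tri>)

count : ∀ {m} → (Fin m → Bool) → ℕ
count g = ∣ tabulate g ∣

_⊆ᵇ_ : ∀ {m} → (Fin m → Bool) → (Fin m → Bool) → Set
g ⊆ᵇ h = ∀ x → g x ≡ true → h x ≡ true

module _ {m : ℕ} where

  ∈-tabulate⁺ : ∀ {g : Fin m → Bool} {x} → g x ≡ true → x ∈ tabulate g
  ∈-tabulate⁺ {g} {x} gx = lookup⇒[]= x (tabulate g) (trans (lookup∘tabulate g x) gx)

  ∈-tabulate⁻ : ∀ {g : Fin m → Bool} {x} → x ∈ tabulate g → g x ≡ true
  ∈-tabulate⁻ {g} {x} x∈ = trans (sym (lookup∘tabulate g x)) ([]=⇒lookup x∈)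

  count-cong : ∀ {g h : Fin m → Bool} → (∀ x → g x ≡ h x) → count g ≡ count h
  count-cong g≗h = cong ∣_∣ (tabulate-cong g≗h)

  ⊆ᵇ⇒⊆ : ∀ {g h : Fin m → Bool} → g ⊆ᵇ h → tabulate g ⊆ tabulate h
  ⊆ᵇ⇒⊆ g⊆h x∈ = ∈-tabulate⁺ (g⊆h _ (∈-tabulate⁻ x∈))

  count-mono : ∀ {g h : Fin m → Bool} → g ⊆ᵇ h → count g ≤ count h
  count-mono g⊆h = p⊆q⇒∣p∣≤∣q∣ (⊆ᵇ⇒⊆ g⊆h)

  count-strict : ∀ {g h : Fin m → Bool} {x} → g ⊆ᵇ h → g x ≡ false → h x ≡ true → count g < count h
  count-strict {x = x} g⊆h gx hx =
    p⊂q⇒∣p∣<∣q∣ (⊆ᵇ⇒⊆ g⊆h , x , ∈-tabulate⁺ hx , λ x∈ → true≢false (trans (sym (∈-tabulate⁻ x∈)) gx))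
    where
    true≢false : true ≢ false
    true≢false ()

  count≤ : ∀ (g : Fin m → Bool) → count g ≤ m
  count≤ g = ∣p∣≤n (tabulate g)

  count-all : ∀ {g : Fin m → Bool} → (∀ x → g x ≡ true) → count g ≡ m
  count-all {g} all = ≤-antisym (count≤ g)
    (subst (_≤ count g) (∣⊤∣≡n m) (p⊆q⇒∣p∣≤∣q∣ {p = ⊤} (λ _ → ∈-tabulate⁺ (all _))))

  count≡⇒all : ∀ {g : Fin m → Bool} → count g ≡ m → ∀ x → g x ≡ true
  count≡⇒all {g} full x = begin
    g x                    ≡⟨ lookup∘tabulate g x ⟨
    lookup (tabulate g) x  ≡⟨ cong (λ p → lookup p x) (∣p∣≡n⇒p≡⊤ {p = tabulate g} full) ⟩
    lookup (⊤ {m}) x       ≡⟨ lookup-replicate x true ⟩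
    true                   ∎
    where open ≡-Reasoning

  ⊆ᵇ-or-witness : ∀ (g h : Fin m → Bool) → g ⊆ᵇ h ⊎ ∃ λ x → g x ≡ true × h x ≡ false
  ⊆ᵇ-or-witness g h with any? (λ x → (g x ≟ᵇ true) ×-dec (h x ≟ᵇ false))
  ... | yes witness = inj₂ witness
  ... | no ¬witness = inj₁ g⊆h
    where
    g⊆h : g ⊆ᵇ h
    g⊆h x gx with h x in hx
    ... | true  = refl
    ... | false = ⊥-elim (¬witness (x , gx , hx))

  count-witness : ∀ {g h : Fin m → Bool} → count g < count h → ∃ λ x → g x ≡ false × h x ≡ true
  count-witness {g} {h} g<h with ⊆ᵇ-or-witness h g
  ... | inj₁ h⊆g            = ⊥-elim (<⇒≱ g<h (count-mono h⊆g))
  ... | inj₂ (x , hx , gx) = x , gx , hx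

  count-exchange : ∀ {g h : Fin m → Bool} {x} → count h ≤ count g → g x ≡ false → h x ≡ true
                 → ∃ λ y → g y ≡ true × h y ≡ false
  count-exchange {g} {h} h≤g gx hx with ⊆ᵇ-or-witness g h
  ... | inj₁ g⊆h    = ⊥-elim (<⇒≱ (count-strict g⊆h gx hx) h≤g)
  ... | inj₂ witness = witness

module _ {s : ℕ} where

  countV≡count : ∀ {m} (p : Maybe (Fin s) → Bool) (c : Vec (Maybe (Fin s)) m)
               → countV p c ≡ count (λ e → p (lookup c e))
  countV≡count p []       = refl
  countV≡count p (x ∷ xs) with p x
  ... | true  = cong suc (countV≡count p xs)
  ... | false = countV≡count p xs

  countV-mono : ∀ {m} (p q : Maybe (Fin s) → Bool) (c d : Vec (Maybe (Fin s)) m)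
              → (λ e → p (lookup c e)) ⊆ᵇ (λ e → q (lookup d e)) → countV p c ≤ countV q d
  countV-mono p q c d p⊆q =
    subst₂ _≤_ (sym (countV≡count p c)) (sym (countV≡count q d)) (count-mono p⊆q)

  countV-cong : ∀ {m} (p q : Maybe (Fin s) → Bool) (c d : Vec (Maybe (Fin s)) m)
              → (∀ e → p (lookup c e) ≡ q (lookup d e)) → countV p c ≡ countV q d
  countV-cong p q c d p≗q =
    trans (countV≡count p c) (trans (count-cong p≗q) (sym (countV≡count q d)))

  bit : Bool → ℕ
  bit true  = 1
  bit false = 0

  countV-[]≔ : ∀ {m} (p : Maybe (Fin s) → Bool) (c : Vec (Maybe (Fin s)) m) e y
             → countV p (c [ e ]≔ y) + bit (p (lookup c e)) ≡ countV p c + bit (p y)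
  countV-[]≔ p (x ∷ c) fzero y with p x | p y
  ... | true  | true  = refl
  ... | true  | false = trans (+-comm (countV p c) 1) (sym (+-identityʳ _))
  ... | false | true  = sym (trans (+-comm (countV p c) 1) (sym (+-identityʳ _)))
  ... | false | false = refl
  countV-[]≔ p (x ∷ c) (fsuc e) y with p x
  ... | true  = cong suc (countV-[]≔ p c e y)
  ... | false = countV-[]≔ p c e y

  countV-fresh : ∀ {m} (p : Maybe (Fin s) → Bool) (c : Vec (Maybe (Fin s)) m) {e} y
               → lookup c e ≡ nothing → p nothing ≡ false → countV p (c [ e ]≔ y) ≡ countV p c + bit (p y)
  countV-fresh p c {e} y ce pnothing = begin
    countV p (c [ e ]≔ y)                             ≡⟨ +-identityʳ _ ⟨
    countV p (c [ e ]≔ y) + bit false                 ≡⟨ cong (λ b → countV p (c [ e ]≔ y) + bit b) pce ⟨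
    countV p (c [ e ]≔ y) + bit (p (lookup c e))      ≡⟨ countV-[]≔ p c e y ⟩
    countV p c + bit (p y)                            ∎
    where
    open ≡-Reasoning
    pce : p (lookup c e) ≡ false
    pce = trans (cong p ce) pnothing

  nothing≢just : ∀ {S : Fin s} → nothing ≢ just S
  nothing≢just ()

  isJust≡false⇒nothing : ∀ {m : Maybe (Fin s)} → isJust m ≡ false → m ≡ nothing
  isJust≡false⇒nothing {nothing} _ = refl

  isJust≡true⇒just : ∀ {m : Maybe (Fin s)} → isJust m ≡ true → ∃ λ S → m ≡ just S
  isJust≡true⇒just {just S} _ = S , refl

  Is-just⇒isJust : ∀ {m : Maybe (Fin s)} → Is-just m → isJust m ≡ true
  Is-just⇒isJust (just _) = refl

  isJust⇒Is-just : ∀ {m : Maybe (Fin s)} → isJust m ≡ true → Is-just m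
  isJust⇒Is-just {just _} _ = just tt

  isSet-just : ∀ (S : Fin s) → isSet S (just S) ≡ true
  isSet-just S = dec-true (S ≟F S) refl

  isSet≡true⇒just : ∀ {S} (m : Maybe (Fin s)) → isSet S m ≡ true → m ≡ just S
  isSet≡true⇒just {S} (just T) isSet≡true with T ≟F S
  ... | yes refl = refl

  isSet≡false⇒≢just : ∀ {S} {m : Maybe (Fin s)} → isSet S m ≡ false → m ≢ just S
  isSet≡false⇒≢just {S} isSet≡false refl with () ← trans (sym (isSet-just S)) isSet≡false

  covered? : ∀ (R : Subset s) (m : Maybe (Fin s)) → Dec (∃ λ S → m ≡ just S × S ∈ R)
  covered? R nothing  = no λ { (_ , () , _) }
  covered? R (just T) = map′ (λ T∈R → T , refl , T∈R) (λ { (_ , refl , T∈R) → T∈R }) (T ∈? R)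

  inFam≡covered? : ∀ (R : Subset s) m → inFam R m ≡ does (covered? R m)
  inFam≡covered? R nothing  = refl
  inFam≡covered? R (just T) = refl

  restrictTo : Subset s → Maybe (Fin s) → Maybe (Fin s)
  restrictTo R nothing  = nothing
  restrictTo R (just S) with S ∈? R
  ... | yes _ = just S
  ... | no  _ = nothing

  isJust-restrictTo : ∀ R (m : Maybe (Fin s)) → isJust (restrictTo R m) ≡ inFam R m
  isJust-restrictTo R nothing  = refl
  isJust-restrictTo R (just S) with S ∈? R
  ... | yes _ = refl
  ... | no  _ = refl

  isSet-restrictTo : ∀ R S (m : Maybe (Fin s)) → isSet S (restrictTo R m) ≡ true → isSet S m ≡ true
  isSet-restrictTo R S (just T) isSet≡true with T ∈? R
  ... | yes _ = isSet≡true

  _⊑_ : ∀ {n} → Cover n s → Cover n s → Set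
  c ⊑ c′ = ∀ R → fC c R ≤ fC c′ R

  differ : Maybe (Fin s) → Maybe (Fin s) → Bool
  differ a b = not (does (Maybe.≡-dec _≟F_ a b))

  differ-≢ : ∀ {a b : Maybe (Fin s)} → a ≢ b → differ a b ≡ true
  differ-≢ {a} {b} a≢b = cong not (dec-false (Maybe.≡-dec _≟F_ a b) a≢b)

  differ-≡ : ∀ {a b : Maybe (Fin s)} → a ≡ b → differ a b ≡ false
  differ-≡ {a} {b} a≡b = cong not (dec-true (Maybe.≡-dec _≟F_ a b) a≡b)

  distance : ∀ {n} → Cover n s → Cover n s → ℕ
  distance c d = count (λ x → differ (lookup c x) (lookup d x))

  transfer : ∀ {n} → Cover n s → (e′ e : Fin n) → Fin s → Cover n s
  transfer c e′ e T = c [ e ]≔ just T [ e′ ]≔ nothing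

  module Transfer {n : ℕ} (c : Cover n s) (e′ e : Fin n) (T : Fin s)
                  (ce : lookup c e ≡ nothing) (ce′ : lookup c e′ ≡ just T) where

    e≢e′ : e ≢ e′
    e≢e′ refl = nothing≢just (trans (sym ce) ce′)

    transfer-source : lookup (transfer c e′ e T) e′ ≡ nothing
    transfer-source = lookup∘update e′ (c [ e ]≔ just T) nothing

    transfer-target : lookup (transfer c e′ e T) e ≡ just T
    transfer-target = trans (lookup∘update′ e≢e′ (c [ e ]≔ just T) nothing) (lookup∘update e c (just T))

    transfer-other : ∀ {x} → x ≢ e′ → x ≢ e → lookup (transfer c e′ e T) x ≡ lookup c x
    transfer-other x≢e′ x≢e = trans (lookup∘update′ x≢e′ (c [ e ]≔ just T) nothing) (lookup∘update′ x≢e c (just T))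

    countV-transfer : ∀ (p : Maybe (Fin s) → Bool) → p nothing ≡ false → countV p (transfer c e′ e T) ≡ countV p c
    countV-transfer p pnothing = +-cancelʳ-≡ (bit (p (just T))) _ _ (begin
      countV p (transfer c e′ e T) + bit (p (just T))          ≡⟨ cong (λ m → countV p (transfer c e′ e T) + bit (p m)) c₀e′ ⟨
      countV p (c₀ [ e′ ]≔ nothing) + bit (p (lookup c₀ e′))    ≡⟨ countV-[]≔ p c₀ e′ nothing ⟩
      countV p c₀ + bit (p nothing)                             ≡⟨ cong (λ b → countV p c₀ + bit b) pnothing ⟩
      countV p c₀ + 0                                           ≡⟨ +-identityʳ _ ⟩
      countV p c₀                                               ≡⟨ countV-fresh p c (just T) ce pnothing ⟩
      countV p c + bit (p (just T))                             ∎)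
      where
      open ≡-Reasoning
      c₀ : Cover n s
      c₀ = c [ e ]≔ just T
      c₀e′ : lookup c₀ e′ ≡ just T
      c₀e′ = trans (lookup∘update′ (e≢e′ ∘ sym) c (just T)) ce′

    distance-transfer : ∀ {d : Cover n s} → lookup d e ≡ just T → lookup d e′ ≢ just T
                      → distance (transfer c e′ e T) d < distance c d
    distance-transfer {d} de de′ = count-strict transfer⊆c (differ-≡ (trans transfer-target (sym de)))
                                                        (differ-≢ (λ eq → nothing≢just (trans (sym ce) (trans eq de))))
      where
      transfer⊆c : (λ x → differ (lookup (transfer c e′ e T) x) (lookup d x)) ⊆ᵇ (λ x → differ (lookup c x) (lookup d x))
      transfer⊆c x differs with x ≟F e′ | x ≟F e
      ... | yes refl | _      = differ-≢ (λ eq → de′ (trans (sym eq) ce′))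
      ... | no _     | yes refl = differ-≢ (λ eq → nothing≢just (trans (sym ce) (trans eq de)))
      ... | no x≢e′  | no x≢e = trans (cong (λ m → differ m (lookup d x)) (sym (transfer-other x≢e′ x≢e))) differs

module Covers {n s : ℕ} (mem : Fin s → Subset n) (k : Fin s → ℕ) where

  Assign-mono : ∀ {P Q e} (m : Maybe (Fin s)) → P ⊆ Q → Assign mem k P e m → Assign mem k Q e m
  Assign-mono nothing  _   _           = tt
  Assign-mono (just S) P⊆Q (S∈P , e∈S) = P⊆Q S∈P , e∈S

  Feasible-mono : ∀ {P Q} (c : Cover n s) → P ⊆ Q → Feasible mem k P c → Feasible mem k Q c
  Feasible-mono c P⊆Q (assigned , loaded) = (λ e → Assign-mono (lookup c e) P⊆Q (assigned e)) , loaded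

  inFam≡isJust : ∀ {P : Subset s} {e} (m : Maybe (Fin s)) → Assign mem k P e m → inFam P m ≡ isJust m
  inFam≡isJust nothing  _         = refl
  inFam≡isJust {P} (just S) (S∈P , _) = dec-true (S ∈? P) S∈P

  fC≡size : ∀ {P} (c : Cover n s) → Feasible mem k P c → fC c P ≡ size c
  fC≡size {P} c (assigned , _) = countV-cong (inFam P) isJust c c (λ e → inFam≡isJust (lookup c e) (assigned e))

  emptyCover : Cover n s
  emptyCover = replicate n nothing

  countV-replicate-nothing : ∀ m (p : Maybe (Fin s) → Bool) → p nothing ≡ false
                           → countV p (replicate m nothing) ≡ 0
  countV-replicate-nothing zero    p pnothing = refl
  countV-replicate-nothing (suc m) p pnothing rewrite pnothing = countV-replicate-nothing m p pnothing

  emptyCover-feasible : ∀ P → Feasible mem k P emptyCover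
  emptyCover-feasible P = (λ e → subst (Assign mem k P e) (sym (lookup-replicate e nothing)) tt)
                        , (λ S → subst (_≤ k S) (sym (countV-replicate-nothing n (isSet S) refl)) z≤n)

  ∈-allCovers : ∀ {m} (c : Vec (Maybe (Fin s)) m) → c ∈ₗ allCovers mem k m
  ∈-allCovers []      = here refl
  ∈-allCovers (x ∷ c) =
    ∈-concatMap⁺ (λ y → map (y ∷_) (allCovers mem k _)) (lose (∈-allMaybe x) (∈-map⁺ (x ∷_) (∈-allCovers c)))
    where
    ∈-allMaybe : ∀ x → x ∈ₗ allMaybe mem k
    ∈-allMaybe nothing  = here refl
    ∈-allMaybe (just S) = there (∈-map⁺ just (∈-allFin S))

  sizes : Subset s → List ℕ
  sizes P = map size (filter (feasible? mem k P) (allCovers mem k n))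

  size≤f : ∀ {P} (c : Cover n s) → Feasible mem k P c → size c ≤ f mem k P
  size≤f {P} c fc = foldr-preservesᵒ ⊔-upper 0 (sizes P) (inj₂ (lose size∈ ≤-refl))
    where
    size∈ : size c ∈ₗ sizes P
    size∈ = ∈-map⁺ size (∈-filter⁺ (feasible? mem k P) (∈-allCovers c) fc)
    ⊔-upper : ∀ x y → size c ≤ x ⊎ size c ≤ y → size c ≤ x ⊔ y
    ⊔-upper x y (inj₁ c≤x) = m≤n⇒m≤n⊔o y c≤x
    ⊔-upper x y (inj₂ c≤y) = m≤n⇒m≤o⊔n x c≤y

  Attained : Subset s → ℕ → Set
  Attained P v = ∃ λ d → Feasible mem k P d × size d ≡ v

  f-attained : ∀ P → Attained P (f mem k P)
  f-attained P = foldr-preservesᵇ ⊔-attained empty-attained (tabulateₐ size-attained)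
    where
    ⊔-attained : ∀ {x y} → Attained P x → Attained P y → Attained P (x ⊔ y)
    ⊔-attained {x} {y} ax ay with ⊔-sel x y
    ... | inj₁ x⊔y≡x = subst (Attained P) (sym x⊔y≡x) ax
    ... | inj₂ x⊔y≡y = subst (Attained P) (sym x⊔y≡y) ay
    empty-attained : Attained P 0
    empty-attained = emptyCover , emptyCover-feasible P , countV-replicate-nothing n isJust refl
    size-attained : ∀ {v} → v ∈ₗ sizes P → Attained P v
    size-attained v∈ with d , d∈ , refl ← ∈-map⁻ size v∈ =
      d , proj₂ (∈-filter⁻ (feasible? mem k P) {xs = allCovers mem k n} d∈) , refl

  Assign-restrictTo : ∀ {P Q e} (m : Maybe (Fin s)) → Assign mem k Q e m → Assign mem k P e (restrictTo P m)
  Assign-restrictTo nothing _ = tt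
  Assign-restrictTo {P} (just S) (_ , e∈S) with S ∈? P
  ... | yes S∈P = S∈P , e∈S
  ... | no  _   = tt

  restrictTo-feasible : ∀ {P Q} (c : Cover n s) → Feasible mem k Q c → Feasible mem k P (mapᵥ (restrictTo P) c)
  restrictTo-feasible {P} c (assigned , loaded) = assigned′ , loaded′
    where
    assigned′ : ∀ e → Assign mem k P e (lookup (mapᵥ (restrictTo P) c) e)
    assigned′ e = subst (Assign mem k P e) (sym (lookup-map e (restrictTo P) c)) (Assign-restrictTo (lookup c e) (assigned e))
    loaded′ : ∀ S → load (mapᵥ (restrictTo P) c) S ≤ k S
    loaded′ S = ≤-trans (countV-mono (isSet S) (isSet S) (mapᵥ (restrictTo P) c) c restricted⊆) (loaded S)
      where
      restricted⊆ : (λ e → isSet S (lookup (mapᵥ (restrictTo P) c) e)) ⊆ᵇ (λ e → isSet S (lookup c e))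
      restricted⊆ e isSet≡true =
        isSet-restrictTo P S (lookup c e) (trans (cong (isSet S) (sym (lookup-map e (restrictTo P) c))) isSet≡true)

  fC≤f : ∀ {Q} P (c : Cover n s) → Feasible mem k Q c → fC c P ≤ f mem k P
  fC≤f P c fc = subst (_≤ f mem k P) size-restricted (size≤f (mapᵥ (restrictTo P) c) (restrictTo-feasible c fc))
    where
    size-restricted : size (mapᵥ (restrictTo P) c) ≡ fC c P
    size-restricted = countV-cong isJust (inFam P) (mapᵥ (restrictTo P) c) c
      (λ e → trans (cong isJust (lookup-map e (restrictTo P) c)) (isJust-restrictTo P (lookup c e)))

  Extension : Subset s → Cover n s → ℕ → Set
  Extension Q c v = ∃ λ c′ → Feasible mem k Q c′ × size c′ ≡ v × c ⊑ c′

  augment-spare : ∀ {Q} (c : Cover n s) {e T} → lookup c e ≡ nothing → Assign mem k Q e (just T)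
                → load c T < k T → Feasible mem k Q c
                → Feasible mem k Q (c [ e ]≔ just T) × size (c [ e ]≔ just T) ≡ suc (size c) × c ⊑ (c [ e ]≔ just T)
  augment-spare {Q} c {e} {T} ce eT load< (assigned , loaded) = (assigned′ , loaded′) , size′ , grows
    where
    c′ : Cover n s
    c′ = c [ e ]≔ just T
    assigned′ : ∀ x → Assign mem k Q x (lookup c′ x)
    assigned′ x with x ≟F e
    ... | yes refl = subst (Assign mem k Q x) (sym (lookup∘update x c (just T))) eT
    ... | no x≢e   = subst (Assign mem k Q x) (sym (lookup∘update′ x≢e c (just T))) (assigned x)
    loaded′ : ∀ S → load c′ S ≤ k S
    loaded′ S with isSet S (just T) in isSetT | countV-fresh (isSet S) c (just T) ce refl
    ... | false | load′≡ = subst (_≤ k S) (sym (trans load′≡ (+-identityʳ _))) (loaded S)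
    ... | true  | load′≡ with refl ← isSet≡true⇒just (just T) isSetT =
      subst (_≤ k S) (sym (trans load′≡ (+-comm _ 1))) load<
    size′ : size c′ ≡ suc (size c)
    size′ = trans (countV-fresh isJust c (just T) ce refl) (+-comm _ 1)
    grows : c ⊑ c′
    grows R = subst (fC c R ≤_) (sym (countV-fresh (inFam R) c (just T) ce refl)) (m≤m+n _ _)

  transfer-feasible : ∀ {Q} (c : Cover n s) {e′ e T} (ce : lookup c e ≡ nothing) (ce′ : lookup c e′ ≡ just T)
                    → Assign mem k Q e (just T) → Feasible mem k Q c → Feasible mem k Q (transfer c e′ e T)
  transfer-feasible {Q} c {e′} {e} {T} ce ce′ eT (assigned , loaded) = assigned′ , loaded′
    where
    open Transfer c e′ e T ce ce′
    assigned′ : ∀ x → Assign mem k Q x (lookup (transfer c e′ e T) x)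
    assigned′ x with x ≟F e′ | x ≟F e
    ... | yes refl | _        = subst (Assign mem k Q x) (sym transfer-source) tt
    ... | no _     | yes refl = subst (Assign mem k Q x) (sym transfer-target) eT
    ... | no x≢e′  | no x≢e   = subst (Assign mem k Q x) (sym (transfer-other x≢e′ x≢e)) (assigned x)
    loaded′ : ∀ S → load (transfer c e′ e T) S ≤ k S
    loaded′ S = subst (_≤ k S) (sym (countV-transfer (isSet S) refl)) (loaded S)

  augment : ∀ t {Q} (c d : Cover n s) → distance c d ≤ t → Feasible mem k Q c → Feasible mem k Q d
          → size c < size d → Extension Q c (suc (size c))

  augment-at : ∀ t {Q} (c d : Cover n s) {e T} → distance c d ≤ t → Feasible mem k Q c → Feasible mem k Q d
             → size c < size d → lookup c e ≡ nothing → lookup d e ≡ just T → Assign mem k Q e (just T)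
             → Extension Q c (suc (size c))
  augment-at t {Q} c d {e} {T} dist≤t fc fd size< ce de eT with load c T <? k T
  ... | yes load< = let fc′ , size′ , grows = augment-spare c ce eT load< fc in c [ e ]≔ just T , fc′ , size′ , grows
  ... | no load≮  = step t dist≤t
    where
    -- load d T ≤ k T ≤ load c T while d gives e to T and c does not, so c gives T some e′ that d does not.
    saturated : ∃ λ e′ → isSet T (lookup c e′) ≡ true × isSet T (lookup d e′) ≡ false
    saturated = count-exchange
      (subst₂ _≤_ (countV≡count (isSet T) d) (countV≡count (isSet T) c) (≤-trans (proj₂ fd T) (≮⇒≥ load≮)))
      (cong (isSet T) ce) (trans (cong (isSet T) de) (isSet-just T))
    e′ : Fin n
    e′ = proj₁ saturated
    ce′ : lookup c e′ ≡ just T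
    ce′ = isSet≡true⇒just (lookup c e′) (proj₁ (proj₂ saturated))
    open Transfer c e′ e T ce ce′
    c₁ : Cover n s
    c₁ = transfer c e′ e T
    closer : distance c₁ d < distance c d
    closer = distance-transfer {d} de (isSet≡false⇒≢just (proj₂ (proj₂ saturated)))
    size₁ : size c₁ ≡ size c
    size₁ = countV-transfer isJust refl
    step : ∀ t → distance c d ≤ t → Extension Q c (suc (size c))
    step zero    dist≤0   = ⊥-elim (n≮0 (<-≤-trans closer dist≤0))
    step (suc t) dist≤1+t
      with c′ , fc′ , size′ , grows ← augment t c₁ d (≤-pred (<-≤-trans closer dist≤1+t))
                                        (transfer-feasible c ce ce′ eT fc) fd (subst (_< size d) (sym size₁) size<)
      = c′ , fc′ , trans size′ (cong suc size₁) , λ R → subst (_≤ fC c′ R) (countV-transfer (inFam R) refl) (grows R)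

  augment t {Q} c d dist≤t fc fd size<
    with e , ce , de ← count-witness (subst₂ _<_ (countV≡count isJust c) (countV≡count isJust d) size<)
    with T , deT ← isJust≡true⇒just de
    = augment-at t c d dist≤t fc fd size< (isJust≡false⇒nothing ce) deT (subst (Assign mem k Q e) deT (proj₁ fd e))

  augmentBy : ∀ u {Q} (c d : Cover n s) → size c + u ≡ size d → Feasible mem k Q c → Feasible mem k Q d
            → Extension Q c (size d)
  augmentBy zero    c d size≡ fc fd = c , fc , trans (sym (+-identityʳ _)) size≡ , λ _ → ≤-refl
  augmentBy (suc u) c d size≡ fc fd
    with c₁ , fc₁ , size₁ , grows₁ ← augment n c d (count≤ _) fc fd (subst (size c <_) size≡ (m<m+n _ z<s))
    with c′ , fc′ , size′ , grows′ ← augmentBy u c₁ d (trans (cong (_+ u) size₁) (trans (sym (+-suc _ u)) size≡)) fc₁ fd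
    = c′ , fc′ , size′ , λ R → ≤-trans (grows₁ R) (grows′ R)

  extendToMaximum : ∀ {Q} (c : Cover n s) → Feasible mem k Q c → Extension Q c (f mem k Q)
  extendToMaximum {Q} c fc
    with d , fd , size-d ← f-attained Q
    with c′ , fc′ , size′ , grows ← augmentBy (size d ∸ size c) c d
                                      (m+[n∸m]≡n (subst (size c ≤_) (sym size-d) (size≤f c fc))) fc fd
    = c′ , fc′ , trans size′ size-d , grows

  nestedMaximum : ∀ (P : ℕ → Subset s) → (∀ i → P i ⊆ P (suc i)) → ∀ i
                → ∃ λ c → Feasible mem k (P i) c × (∀ j → j ≤ i → fC c (P j) ≡ f mem k (P j))
  nestedMaximum P chain zero with d , fd , size-d ← f-attained (P 0) = d , fd , maximal
    where
    maximal : ∀ j → j ≤ 0 → fC d (P j) ≡ f mem k (P j)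
    maximal zero z≤n = trans (fC≡size d fd) size-d
  nestedMaximum P chain (suc i)
    with c , fc , maximal ← nestedMaximum P chain i
    with c′ , fc′ , size′ , grows ← extendToMaximum c (Feasible-mono c (chain i) fc)
    = c′ , fc′ , maximal′
    where
    maximal′ : ∀ j → j ≤ suc i → fC c′ (P j) ≡ f mem k (P j)
    maximal′ j j≤1+i with m≤n⇒m<n∨m≡n j≤1+i
    ... | inj₁ j<1+i = ≤-antisym (fC≤f (P j) c′ fc′) (subst (_≤ fC c′ (P j)) (maximal j (≤-pred j<1+i)) (grows (P j)))
    ... | inj₂ refl  = trans (fC≡size c′ fc′) size′

  maximum-full : ∀ {P} (c : Cover n s) → Valid mem k P → size c ≡ f mem k P → FullCover c
  maximum-full {P} c (g , fg , g-full) size≡ e =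
    isJust⇒Is-just (count≡⇒all (trans (sym (countV≡count isJust c)) size≡n) e)
    where
    size-g : size g ≡ n
    size-g = trans (countV≡count isJust g) (count-all (λ x → Is-just⇒isJust (g-full x)))
    size≡n : size c ≡ n
    size≡n = ≤-antisym (subst (_≤ n) (sym (countV≡count isJust c)) (count≤ _))
                       (subst₂ _≤_ size-g (sym size≡) (size≤f g fg))

does≡true⇒ : ∀ {a} {A : Set a} (a? : Dec A) → does a? ≡ true → A
does≡true⇒ (yes a) _ = a

injective⇒surjective : ∀ {n} {g : Fin n → Fin n} → Injective _≡_ _≡_ g → ∀ j → ∃ λ i → g i ≡ j
injective⇒surjective {suc n} {g} g-injective j with any? (λ i → g i ≟F j)
... | yes hit = hit
... | no miss = ⊥-elim (<-irrefl refl (injective⇒≤ punched-injective))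
  where
  j≢g : ∀ i → j ≢ g i
  j≢g i j≡gi = miss (i , sym j≡gi)
  punched : Fin (suc n) → Fin n
  punched i = punchOut (j≢g i)
  punched-injective : Injective _≡_ _≡_ punched
  punched-injective eq = g-injective (punchOut-injective (j≢g _) (j≢g _) eq)

module Ranking {n : ℕ} (K : Fin n → ℕ) (K-injective : Injective _≡_ _≡_ K) where

  below : ℕ → Fin n → Bool
  below t x = does (K x <? t)

  below-mono : ∀ {t u} → t ≤ u → below t ⊆ᵇ below u
  below-mono {t} {u} t≤u x x<t = dec-true (K x <? u) (<-≤-trans (does≡true⇒ (K x <? t) x<t) t≤u)

  rank : Fin n → ℕ
  rank e = count (below (K e))

  ¬below-self : ∀ e → below (K e) e ≡ false
  ¬below-self e = dec-false (K e <? K e) (<-irrefl refl)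

  rank<n : ∀ e → rank e < n
  rank<n e = subst (rank e <_) (count-all {g = λ _ → true} (λ _ → refl))
    (count-strict {g = below (K e)} {h = λ _ → true} (λ _ _ → refl) (¬below-self e) refl)

  rank<count-below : ∀ {e t} → K e < t → rank e < count (below t)
  rank<count-below {e} {t} Ke<t = count-strict {g = below (K e)} {h = below t}
    (below-mono (<⇒≤ Ke<t)) (¬below-self e) (dec-true (K e <? t) Ke<t)

  rank<count-below⁻¹ : ∀ {e t} → rank e < count (below t) → K e < t
  rank<count-below⁻¹ {e} {t} rank< with K e <? t
  ... | yes Ke<t = Ke<t
  ... | no Ke≮t  = ⊥-elim (<⇒≱ rank< (count-mono (below-mono (≮⇒≥ Ke≮t))))

  rank-injective : ∀ {e e′} → rank e ≡ rank e′ → e ≡ e′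
  rank-injective {e} {e′} rank≡ with <-cmp (K e) (K e′)
  ... | tri< Ke<Ke′ _ _ = ⊥-elim (<-irrefl rank≡ (rank<count-below Ke<Ke′))
  ... | tri≈ _ Ke≡Ke′ _ = K-injective Ke≡Ke′
  ... | tri> _ _ Ke′<Ke = ⊥-elim (<-irrefl (sym rank≡) (rank<count-below Ke′<Ke))

  rankFin : Fin n → Fin n
  rankFin e = fromℕ< (rank<n e)

  rankFin-injective : Injective _≡_ _≡_ rankFin
  rankFin-injective {e} {e′} eq =
    rank-injective (trans (sym (toℕ-fromℕ< (rank<n e))) (trans (cong toℕ eq) (toℕ-fromℕ< (rank<n e′))))

  unrank : Fin n → Fin n
  unrank j = proj₁ (injective⇒surjective rankFin-injective j)

  rankPermutation : Permutation′ n
  rankPermutation = permutation unrank rankFin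
    (λ e → rankFin-injective (proj₂ (injective⇒surjective rankFin-injective (rankFin e))))
    (λ j → proj₂ (injective⇒surjective rankFin-injective j))

  rank-unrank : ∀ j → rank (rankPermutation ⟨$⟩ʳ j) ≡ toℕ j
  rank-unrank j =
    trans (sym (toℕ-fromℕ< (rank<n (unrank j)))) (cong toℕ (proj₂ (injective⇒surjective rankFin-injective j)))

  rankPermutation-below : ∀ t j → K (rankPermutation ⟨$⟩ʳ j) < t ⇔ toℕ j < count (below t)
  rankPermutation-below t j = mk⇔
    (λ K< → subst (_< count (below t)) (rank-unrank j) (rank<count-below K<))
    (λ j< → rank<count-below⁻¹ (subst (_< count (below t)) (sym (rank-unrank j)) j<))

module _ {n : ℕ} (key : Fin n → ℕ) where

  tieBreak : Fin n → ℕ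
  tieBreak e = key e * n + toℕ e

  key<⇔tieBreak< : ∀ e t → key e < t ⇔ tieBreak e < t * n
  key<⇔tieBreak< e t = mk⇔ to from
    where
    to : key e < t → tieBreak e < t * n
    to key<t = begin-strict
      key e * n + toℕ e  <⟨ +-monoʳ-< (key e * n) (toℕ<n e) ⟩
      key e * n + n      ≡⟨ +-comm (key e * n) n ⟩
      suc (key e) * n    ≤⟨ *-monoˡ-≤ n key<t ⟩
      t * n              ∎
      where open ≤-Reasoning
    from : tieBreak e < t * n → key e < t
    from tieBreak< with key e <? t
    ... | yes key<t = key<t
    ... | no key≮t  = ⊥-elim (<⇒≱ tieBreak< (≤-trans (*-monoˡ-≤ n (≮⇒≥ key≮t)) (m≤m+n _ _)))

  tieBreak-mono : ∀ {e e′} → key e < key e′ → tieBreak e < tieBreak e′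
  tieBreak-mono {e} {e′} key< = <-≤-trans (Equivalence.to (key<⇔tieBreak< e (key e′)) key<) (m≤m+n _ _)

  tieBreak-injective : Injective _≡_ _≡_ tieBreak
  tieBreak-injective {e} {e′} eq with <-cmp (key e) (key e′)
  ... | tri< key< _ _ = ⊥-elim (<-irrefl eq (tieBreak-mono key<))
  ... | tri> _ _ key> = ⊥-elim (<-irrefl (sym eq) (tieBreak-mono key>))
  ... | tri≈ _ key≡ _ = toℕ-injective (+-cancelˡ-≡ (key e * n) _ _ (trans eq (cong (λ x → x * n + toℕ e′) (sym key≡))))

  sortingPermutation : ∃ λ (π : Permutation′ n) → ∀ t j → key (π ⟨$⟩ʳ j) < t ⇔ toℕ j < count (λ e → does (key e <? t))
  sortingPermutation = rankPermutation , λ t j →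
    ⇔.trans (key<⇔tieBreak< _ t)
            (subst (λ N → tieBreak (rankPermutation ⟨$⟩ʳ j) < t * n ⇔ toℕ j < N) (count-below t)
                   (rankPermutation-below (t * n) j))
    where
    open Ranking tieBreak tieBreak-injective
    count-below : ∀ t → count (below (t * n)) ≡ count (λ e → does (key e <? t))
    count-below t = count-cong (λ e → sym (does-⇔ (key<⇔tieBreak< e t) (key e <? t) (tieBreak e <? t * n)))

module _ {s : ℕ} where

  firstIndex : Fin s → List (Fin s) → ℕ
  firstIndex S []        = 0
  firstIndex S (T ∷ seq) with S ≟F T
  ... | yes _ = 0
  ... | no  _ = suc (firstIndex S seq)

  ∈-Pref⇔firstIndex< : ∀ (seq : List (Fin s)) {i} → i ≤ length seq → ∀ S → S ∈ Pref seq i ⇔ firstIndex S seq < i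
  ∈-Pref⇔firstIndex< []        {zero}  _         S = mk⇔ (⊥-elim ∘ ∉⊥) λ ()
  ∈-Pref⇔firstIndex< (T ∷ seq) {zero}  _         S = mk⇔ (⊥-elim ∘ ∉⊥) λ ()
  ∈-Pref⇔firstIndex< (T ∷ seq) {suc i} (s≤s i≤) S with S ≟F T
  ... | yes refl = mk⇔ (λ _ → s≤s z≤n) (λ _ → x∈p∪q⁺ (inj₁ (x∈⁅x⁆ S)))
  ... | no S≢T   = mk⇔ to from
    where
    to : S ∈ Pref (T ∷ seq) (suc i) → suc (firstIndex S seq) < suc i
    to S∈ with x∈p∪q⁻ ⁅ T ⁆ (Pref seq i) S∈
    ... | inj₁ S∈⁅T⁆ = ⊥-elim (S≢T (x∈⁅y⁆⇒x≡y T S∈⁅T⁆))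
    ... | inj₂ S∈Pref = s≤s (Equivalence.to (∈-Pref⇔firstIndex< seq i≤ S) S∈Pref)
    from : suc (firstIndex S seq) < suc i → S ∈ Pref (T ∷ seq) (suc i)
    from (s≤s index<) = x∈p∪q⁺ {p = ⁅ T ⁆} (inj₂ (Equivalence.from (∈-Pref⇔firstIndex< seq i≤ S) index<))

  Pref-⊆ : ∀ (seq : List (Fin s)) i → Pref seq i ⊆ Pref seq (suc i)
  Pref-⊆ []        zero    S∈ = S∈
  Pref-⊆ []        (suc i) S∈ = S∈
  Pref-⊆ (T ∷ seq) zero    S∈ = ⊥-elim (∉⊥ S∈)
  Pref-⊆ (T ∷ seq) (suc i) S∈ with x∈p∪q⁻ ⁅ T ⁆ (Pref seq i) S∈
  ... | inj₁ S∈⁅T⁆  = x∈p∪q⁺ (inj₁ S∈⁅T⁆)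
  ... | inj₂ S∈Pref = x∈p∪q⁺ {p = ⁅ T ⁆} (inj₂ (Pref-⊆ seq i S∈Pref))

  -- The (0-based) position in seq of the set covering an element; uncovered elements get length seq.
  stage : List (Fin s) → Maybe (Fin s) → ℕ
  stage seq nothing  = length seq
  stage seq (just S) = firstIndex S seq

  coveredByPref⇔stage< : ∀ (seq : List (Fin s)) {i} → i ≤ length seq → ∀ m
                       → (∃ λ S → m ≡ just S × S ∈ Pref seq i) ⇔ stage seq m < i
  coveredByPref⇔stage< seq i≤ nothing  = mk⇔ (λ { (_ , () , _) }) (λ length< → ⊥-elim (<⇒≱ length< i≤))
  coveredByPref⇔stage< seq i≤ (just T) = mk⇔
    (λ { (_ , refl , T∈) → Equivalence.to (∈-Pref⇔firstIndex< seq i≤ T) T∈ })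
    (λ index< → T , refl , Equivalence.from (∈-Pref⇔firstIndex< seq i≤ T) index<)

  fC-Pref≡count : ∀ {n} (c : Cover n s) (seq : List (Fin s)) {i} → i ≤ length seq
                → fC c (Pref seq i) ≡ count (λ e → does (stage seq (lookup c e) <? i))
  fC-Pref≡count c seq {i} i≤ = trans (countV≡count (inFam (Pref seq i)) c) (count-cong λ e →
    trans (inFam≡covered? (Pref seq i) (lookup c e))
          (does-⇔ (coveredByPref⇔stage< seq i≤ (lookup c e))
                  (covered? (Pref seq i) (lookup c e)) (stage seq (lookup c e) <? i)))

lemma3 : ∀ {n s : ℕ} (mem : Fin s → Subset n) (k : Fin s → ℕ) (w : Fin s → ℚ)
         → ((S : Fin s) → 0 < k S)
         → ((S : Fin s) → 0ℚ <ℚ w S)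
         → Valid mem k ⊤
         → (seq : List (Fin s)) → GreedyRun mem k w seq
         → ∃ λ (c : Cover n s) → Feasible mem k (toSub seq) c × FullCover c
           × ∃ λ (x : Permutation′ n) →
             (i : ℕ) → 1 ≤ i → i ≤ length seq →
               (fC c (Pref seq i) ≡ f mem k (Pref seq i))
               × ((j : Fin n) →
                    (CoveredBy c (Pref seq i) (x ⟨$⟩ʳ j) → toℕ j < f mem k (Pref seq i))
                  × (toℕ j < f mem k (Pref seq i) → CoveredBy c (Pref seq i) (x ⟨$⟩ʳ j)))
lemma3 {n} {s} mem k w _ _ _ seq (_ , valid) = c , feasible , full , π , prefixes
  where
  open Covers mem k
  nested : ∃ λ c → Feasible mem k (Pref seq (length seq)) c
                 × (∀ i → i ≤ length seq → fC c (Pref seq i) ≡ f mem k (Pref seq i))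
  nested = nestedMaximum (Pref seq) (Pref-⊆ seq) (length seq)
  c : Cover n s
  c = proj₁ nested
  maximal : ∀ i → i ≤ length seq → fC c (Pref seq i) ≡ f mem k (Pref seq i)
  maximal = proj₂ (proj₂ nested)
  Pref-all : Pref seq (length seq) ≡ toSub seq
  Pref-all = cong toSub (take-all (length seq) seq ≤-refl)
  feasible : Feasible mem k (toSub seq) c
  feasible = subst (λ P → Feasible mem k P c) Pref-all (proj₁ (proj₂ nested))
  full : FullCover c
  full = maximum-full c valid
    (trans (sym (fC≡size c feasible)) (subst (λ P → fC c P ≡ f mem k P) Pref-all (maximal (length seq) ≤-refl)))
  sorted : ∃ λ (π : Permutation′ n) → ∀ t j → stage seq (lookup c (π ⟨$⟩ʳ j)) < t
                                           ⇔ toℕ j < count (λ e → does (stage seq (lookup c e) <? t))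
  sorted = sortingPermutation (λ e → stage seq (lookup c e))
  π : Permutation′ n
  π = proj₁ sorted
  covered⇔position : ∀ {i} → i ≤ length seq → ∀ j
                   → CoveredBy c (Pref seq i) (π ⟨$⟩ʳ j) ⇔ toℕ j < f mem k (Pref seq i)
  covered⇔position {i} i≤ j = ⇔.trans (coveredByPref⇔stage< seq i≤ _)
    (subst (λ N → stage seq (lookup c (π ⟨$⟩ʳ j)) < i ⇔ toℕ j < N)
           (trans (sym (fC-Pref≡count c seq i≤)) (maximal i i≤)) (proj₂ sorted i j))
  prefixes : ∀ i → 1 ≤ i → i ≤ length seq
           → (fC c (Pref seq i) ≡ f mem k (Pref seq i))
           × ((j : Fin n) → (CoveredBy c (Pref seq i) (π ⟨$⟩ʳ j) → toℕ j < f mem k (Pref seq i))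
                          × (toℕ j < f mem k (Pref seq i) → CoveredBy c (Pref seq i) (π ⟨$⟩ʳ j)))
  prefixes i _ i≤ =
    maximal i i≤ , λ j → Equivalence.to (covered⇔position i≤ j) , Equivalence.from (covered⇔position i≤ j)
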